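{- For every integer $d\ge 1$, the $d$-dimensional hypercube $Q_d$ satisfies $$\mu(Q_d)\ \ge\ \binom{d}{\lfloor d/2\rfloor} + \binom{d}{\lfloor d/2\rfloor+3},$$ where $\binom{d}{k}=0$ for $k>d$.
   Context: For a connected graph $G$ and $X\subseteq V(G)$, two vertices $x,y\in V(G)$ are $X$-visible if there is a shortest $x,y$-path none of whose internal vertices lies in $X$. $X$ is a mutual-visibility set if every two vertices of $X$ are $X$-visible; $\mu(G)$ is the maximum cardinality of a mutual-visibility set of $G$. The hypercube $Q_d$ has vertex set $\{0,1\}^d$, two binary strings being adjacent if and only if they differ in exactly one position. -}

module Defs where

open import Data.Nat using (ℕ; zero; suc; _≤_; _+_)
open import Data.Bool using (Bool)
open import Data.Fin using (Fin)
open import Data.Vec using (Vec; lookup)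
open import Data.List using (List; []; _∷_; length)
open import Data.List.Membership.Propositional using (_∈_)
open import Data.List.Relation.Unary.Unique.Propositional using (Unique)
open import Data.Product using (Σ; ∃; _×_)
open import Relation.Binary.PropositionalEquality using (_≡_)
open import Relation.Nullary using (¬_)

data Walk {V : Set} (Adj : V → V → Set) : V → V → Set where
  []  : ∀ {x} → Walk Adj x x
  _∷_ : ∀ {x y z} → Adj x y → Walk Adj y z → Walk Adj x z

module _ {V : Set} {Adj : V → V → Set} where

  walkLength : ∀ {x y} → Walk Adj x y → ℕ
  walkLength []      = 0
  walkLength (_ ∷ w) = suc (walkLength w)

  internal : ∀ {x y} → Walk Adj x y → List V
  internal []                    = []
  internal (_ ∷ [])              = []
  internal (_∷_ {y = v} _ (e ∷ w)) = v ∷ internal (e ∷ w)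

  IsShortest : ∀ {x y} → Walk Adj x y → Set
  IsShortest {x} {y} w = ∀ (w' : Walk Adj x y) → walkLength w ≤ walkLength w'

Visible : {V : Set} (Adj : V → V → Set) → (V → Set) → V → V → Set
Visible Adj X x y =
  Σ (Walk Adj x y) λ w → IsShortest w × (∀ v → v ∈ internal w → ¬ X v)

IsMutualVisibility : {V : Set} (Adj : V → V → Set) → List V → Set
IsMutualVisibility Adj X =
  Unique X × (∀ x y → x ∈ X → y ∈ X → Visible Adj (λ v → v ∈ X) x y)

QVertex : ℕ → Set
QVertex d = Vec Bool d

QAdj : (d : ℕ) → QVertex d → QVertex d → Set
QAdj d x y =
  Σ (Fin d) λ i → (¬ lookup x i ≡ lookup y i)
    × (∀ j → ¬ j ≡ i → lookup x j ≡ lookup y j)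

μ≥ : {V : Set} (Adj : V → V → Set) → ℕ → Set
μ≥ Adj n = Σ (List _) λ X → IsMutualVisibility Adj X × n ≤ length X

-- Any two vertices whose weights lie between k and k + 3 are joined by a geodesic all
-- of whose internal vertices have weight k + 1 or k + 2: at weight at most k + 1 set
-- a bit in which the current vertex differs from the target, at larger weight clear
-- one, and once no bit of the preferred kind is left go straight to the target.
-- Hence the C(d,k) + C(d,k+3) vertices of weight k or k + 3 are mutually visible.
module Submission where

open import Defs
open import Data.Nat using (ℕ; _≤_; _+_; _/_)
open import Data.Nat.Combinatorics using (_C_)

open import Data.Nat using (zero; suc; _<_; z≤n; s≤s; s≤s⁻¹; _≤?_)
open import Data.Nat.Properties
open import Data.Nat.Combinatorics using (nCk+nC[k+1]≡[n+1]C[k+1])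
open import Data.Bool using (Bool; true; false)
open import Data.Fin using (zero; suc)
import Data.Fin.Properties as Fin
open import Data.Vec using ([]; _∷_)
open import Data.Vec.Properties using (∷-injectiveʳ)
open import Data.Vec.Relation.Binary.Pointwise.Extensional
  using (ext; extensional⇒inductive)
open import Data.Vec.Relation.Binary.Pointwise.Inductive using (Pointwise-≡⇒≡)
open import Data.List using (List; []; [_]; length; map; _++_)
open import Data.List.Properties using (length-++; length-map)
open import Data.List.Membership.Propositional using (_∈_)
open import Data.List.Membership.Propositional.Properties using (∈-map⁻; ∈-++⁻)
open import Data.List.Relation.Unary.All using ([])
open import Data.List.Relation.Unary.Any using (here; there)
open import Data.List.Relation.Unary.Unique.Propositional using (Unique; []; _∷_)
import Data.List.Relation.Unary.Unique.Propositional.Properties as Unique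
open import Data.Product using (Σ; _×_; _,_; proj₁; proj₂)
open import Data.Sum using (_⊎_; inj₁; inj₂)
open import Relation.Binary.PropositionalEquality
  using (_≡_; refl; sym; trans; cong; cong₂; subst; module ≡-Reasoning)
open import Function using (_∘_)
open import Relation.Nullary using (¬_; yes; no; contradiction)

private
  variable
    d j : ℕ

weight₁ : Bool → ℕ
weight₁ true  = 1
weight₁ false = 0

down₁ up₁ hamming₁ : Bool → Bool → ℕ
down₁ true false = 1
down₁ _    _     = 0
up₁ false true = 1
up₁ _     _    = 0
hamming₁ b c = down₁ b c + up₁ b c

weight : QVertex d → ℕ
weight []       = 0
weight (b ∷ bs) = weight₁ b + weight bs

down up hamming : QVertex d → QVertex d → ℕ
down []       []       = 0
down (b ∷ bs) (c ∷ cs) = down₁ b c + down bs cs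
up []       []       = 0
up (b ∷ bs) (c ∷ cs) = up₁ b c + up bs cs
hamming []       []       = 0
hamming (b ∷ bs) (c ∷ cs) = hamming₁ b c + hamming bs cs

hamming-split : (x y : QVertex d) → hamming x y ≡ down x y + up x y
hamming-split []           []           = refl
hamming-split (true  ∷ xs) (true  ∷ ys) = hamming-split xs ys
hamming-split (true  ∷ xs) (false ∷ ys) = cong suc (hamming-split xs ys)
hamming-split (false ∷ xs) (true  ∷ ys) =
  trans (cong suc (hamming-split xs ys)) (sym (+-suc _ _))
hamming-split (false ∷ xs) (false ∷ ys) = hamming-split xs ys

weight+up≡weight+down : (x y : QVertex d) → weight x + up x y ≡ weight y + down x y
weight+up≡weight+down []           []           = refl
weight+up≡weight+down (true  ∷ xs) (true  ∷ ys) = cong suc (weight+up≡weight+down xs ys)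
weight+up≡weight+down (true  ∷ xs) (false ∷ ys) =
  trans (cong suc (weight+up≡weight+down xs ys)) (sym (+-suc _ _))
weight+up≡weight+down (false ∷ xs) (true  ∷ ys) =
  trans (+-suc _ _) (cong suc (weight+up≡weight+down xs ys))
weight+up≡weight+down (false ∷ xs) (false ∷ ys) = weight+up≡weight+down xs ys

down≡0⇒weight+hamming≡weight : (x y : QVertex d) → down x y ≡ 0 →
                               weight x + hamming x y ≡ weight y
down≡0⇒weight+hamming≡weight x y down≡0 = begin
  weight x + hamming x y           ≡⟨ cong (weight x +_) (hamming-split x y) ⟩
  weight x + (down x y + up x y)   ≡⟨ cong (λ n → weight x + (n + up x y)) down≡0 ⟩
  weight x + up x y                ≡⟨ weight+up≡weight+down x y ⟩
  weight y + down x y              ≡⟨ cong (weight y +_) down≡0 ⟩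
  weight y + 0                     ≡⟨ +-identityʳ (weight y) ⟩
  weight y                         ∎
  where open ≡-Reasoning

up≡0⇒weight+hamming≡weight : (x y : QVertex d) → up x y ≡ 0 →
                             weight y + hamming x y ≡ weight x
up≡0⇒weight+hamming≡weight x y up≡0 = begin
  weight y + hamming x y           ≡⟨ cong (weight y +_) (hamming-split x y) ⟩
  weight y + (down x y + up x y)   ≡⟨ cong (λ n → weight y + (down x y + n)) up≡0 ⟩
  weight y + (down x y + 0)        ≡⟨ cong (weight y +_) (+-identityʳ (down x y)) ⟩
  weight y + down x y              ≡⟨ weight+up≡weight+down x y ⟨
  weight x + up x y                ≡⟨ cong (weight x +_) up≡0 ⟩
  weight x + 0                     ≡⟨ +-identityʳ (weight x) ⟩
  weight x                         ∎
  where open ≡-Reasoning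

hamming-refl : (x : QVertex d) → hamming x x ≡ 0
hamming-refl []           = refl
hamming-refl (true  ∷ xs) = hamming-refl xs
hamming-refl (false ∷ xs) = hamming-refl xs

hamming≡0⇒≡ : (x y : QVertex d) → hamming x y ≡ 0 → x ≡ y
hamming≡0⇒≡ []           []           _  = refl
hamming≡0⇒≡ (true  ∷ xs) (true  ∷ ys) eq = cong (true ∷_) (hamming≡0⇒≡ xs ys eq)
hamming≡0⇒≡ (false ∷ xs) (false ∷ ys) eq = cong (false ∷_) (hamming≡0⇒≡ xs ys eq)

hamming₁≤1 : (b c : Bool) → hamming₁ b c ≤ 1
hamming₁≤1 true  true  = z≤n
hamming₁≤1 true  false = s≤s z≤n
hamming₁≤1 false true  = s≤s z≤n
hamming₁≤1 false false = z≤n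

hamming-adj : (x x′ y : QVertex d) → QAdj d x x′ → hamming x y ≤ suc (hamming x′ y)
hamming-adj (b ∷ xs) (b′ ∷ xs′) (c ∷ ys) (zero , _ , agree)
  rewrite Pointwise-≡⇒≡ (extensional⇒inductive {xs = xs} {xs′} (ext λ i → agree (suc i) λ ()))
  = +-mono-≤ (hamming₁≤1 b c) (m≤n+m (hamming xs′ ys) (hamming₁ b′ c))
hamming-adj (b ∷ xs) (b′ ∷ xs′) (c ∷ ys) (suc i , differ , agree)
  rewrite agree zero λ ()
  = ≤-trans (+-monoʳ-≤ (hamming₁ b′ c) (hamming-adj xs xs′ ys tail-adj))
            (≤-reflexive (+-suc _ _))
  where
  tail-adj : QAdj _ xs xs′
  tail-adj = i , differ , λ k k≢i → agree (suc k) (k≢i ∘ Fin.suc-injective)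

hamming≤walkLength : {x y : QVertex d} (w : Walk (QAdj d) x y) → hamming x y ≤ walkLength w
hamming≤walkLength {x = x} []                 = ≤-reflexive (hamming-refl x)
hamming≤walkLength {x = x} {y} (_∷_ {y = x′} e w) =
  ≤-trans (hamming-adj x x′ y e) (s≤s (hamming≤walkLength w))

record Step (x y : QVertex d) : Set where
  constructor step
  field
    {next}   : QVertex d
    adjacent : QAdj d x next
    closer   : hamming x y ≡ suc (hamming next y)

open Step

Descent Ascent : QVertex d → QVertex d → Set
Descent x y = Σ (Step x y) λ s → weight x ≡ suc (weight (next s)) × up (next s) y ≡ up x y
Ascent  x y = Σ (Step x y) λ s → weight (next s) ≡ suc (weight x) × down (next s) y ≡ down x y

flip-adj : ∀ {b c} → ¬ b ≡ c → (xs : QVertex d) → QAdj (suc d) (b ∷ xs) (c ∷ xs)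
flip-adj b≢c xs = zero , b≢c , λ { zero k≢0 → contradiction refl k≢0 ; (suc k) _ → refl }

∷-adj : ∀ b {xs xs′ : QVertex d} → QAdj d xs xs′ → QAdj (suc d) (b ∷ xs) (b ∷ xs′)
∷-adj b (i , differ , agree) =
  suc i , differ , λ { zero _ → refl ; (suc k) k≢i → agree k (k≢i ∘ cong suc) }

∷-step : ∀ b c {xs ys : QVertex d} → Step xs ys → Step (b ∷ xs) (c ∷ ys)
∷-step b c (step {xs′} adj closer) =
  step {next = b ∷ xs′} (∷-adj b adj) (trans (cong (hamming₁ b c +_) closer) (+-suc _ _))

∷-descent : ∀ b c {xs ys : QVertex d} → Descent xs ys → Descent (b ∷ xs) (c ∷ ys)
∷-descent b c (s , lighter , up-same) =
  ∷-step b c s , trans (cong (weight₁ b +_) lighter) (+-suc _ _) , cong (up₁ b c +_) up-same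

∷-ascent : ∀ b c {xs ys : QVertex d} → Ascent xs ys → Ascent (b ∷ xs) (c ∷ ys)
∷-ascent b c (s , heavier , down-same) =
  ∷-step b c s , trans (cong (weight₁ b +_) heavier) (+-suc _ _) , cong (down₁ b c +_) down-same

step-down : (x y : QVertex d) → down x y ≡ suc j → Descent x y
step-down []           []           ()
step-down (true  ∷ xs) (false ∷ ys) _  = step {next = false ∷ xs} (flip-adj (λ ()) xs) refl , refl , refl
step-down (true  ∷ xs) (true  ∷ ys) eq = ∷-descent true true (step-down xs ys eq)
step-down (false ∷ xs) (c     ∷ ys) eq = ∷-descent false c (step-down xs ys eq)

step-up : (x y : QVertex d) → up x y ≡ suc j → Ascent x y
step-up []           []           ()
step-up (false ∷ xs) (true  ∷ ys) _  = step {next = true ∷ xs} (flip-adj (λ ()) xs) refl , refl , refl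
step-up (false ∷ xs) (false ∷ ys) eq = ∷-ascent false false (step-up xs ys eq)
step-up (true  ∷ xs) (c     ∷ ys) eq = ∷-ascent true c (step-up xs ys eq)

ascend : (x y : QVertex d) → down x y ≡ 0 → 0 < hamming x y →
         Σ (Step x y) λ s → weight (next s) ≡ suc (weight x)
                          × (0 < hamming (next s) y → weight (next s) < weight y)
ascend x y down≡0 0<h with up x y in up≡
... | zero = contradiction (trans (hamming-split x y) (cong₂ _+_ down≡0 up≡)) (>⇒≢ 0<h)
... | suc _ with step-up x y up≡
... | s , heavier , down-same = s , heavier , λ 0<h′ →
  subst (weight (next s) <_)
        (down≡0⇒weight+hamming≡weight (next s) y (trans down-same down≡0))
        (m<m+n (weight (next s)) 0<h′)

descend : (x y : QVertex d) → up x y ≡ 0 → 0 < hamming x y →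
          Σ (Step x y) λ s → weight x ≡ suc (weight (next s))
                           × (0 < hamming (next s) y → weight y < weight (next s))
descend x y up≡0 0<h with down x y in down≡
... | zero = contradiction (trans (hamming-split x y) (cong₂ _+_ down≡ up≡0)) (>⇒≢ 0<h)
... | suc _ with step-down x y down≡
... | s , lighter , up-same = s , lighter , λ 0<h′ →
  subst (weight y <_)
        (up≡0⇒weight+hamming≡weight (next s) y (trans up-same up≡0))
        (m<m+n (weight y) 0<h′)

record Geodesic (P : ℕ → Set) (x y : QVertex d) : Set where
  constructor geodesic
  field
    walk       : Walk (QAdj d) x y
    length≡    : walkLength walk ≡ hamming x y
    internal-P : ∀ v → v ∈ internal walk → P (weight v)

geodesic-refl : ∀ {P} (x : QVertex d) → Geodesic P x x
geodesic-refl x = geodesic [] (sym (hamming-refl x)) λ _ ()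

step-geodesic : ∀ {P} {x y : QVertex d} (s : Step x y) →
                (0 < hamming (next s) y → P (weight (next s))) →
                Geodesic P (next s) y → Geodesic P x y
step-geodesic s P-next (geodesic [] len _) =
  geodesic (adjacent s ∷ []) (trans (cong suc len) (sym (closer s))) λ _ ()
step-geodesic s P-next (geodesic (e ∷ w) len P-internal) =
  geodesic (adjacent s ∷ e ∷ w) (trans (cong suc len) (sym (closer s)))
  λ { _ (here refl) → P-next (subst (0 <_) len (s≤s z≤n))
    ; v (there v∈)  → P-internal v v∈ }

geodesic⇒visible : ∀ {P} (X : QVertex d → Set) {x y : QVertex d} →
                   (∀ v → P (weight v) → ¬ X v) → Geodesic P x y → Visible (QAdj d) X x y
geodesic⇒visible X avoid (geodesic w len P-internal) =
  w , (λ w′ → subst (_≤ walkLength w′) (sym len) (hamming≤walkLength w′)) ,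
  λ v v∈ → avoid v (P-internal v v∈)

Strategy : (P : ℕ → Set) (Inv : QVertex d → Set) (y : QVertex d) → Set
Strategy {d} P Inv y = ∀ x → Inv x → 0 < hamming x y →
  Σ (Step x y) λ s → 0 < hamming (next s) y → Inv (next s) × P (weight (next s))

strategy⇒geodesic : ∀ {P Inv} {y : QVertex d} → Strategy P Inv y → ∀ x → Inv x → Geodesic P x y
strategy⇒geodesic {P = P} {Inv} {y} strategy x inv = follow (hamming x y) x refl (λ _ → inv)
  where
  follow : ∀ n x → hamming x y ≡ n → (0 < hamming x y → Inv x) → Geodesic P x y
  follow zero x h≡0 _ =
    subst (λ z → Geodesic P z y) (sym (hamming≡0⇒≡ x y h≡0)) (geodesic-refl y)
  follow (suc n) x h≡ inv =
    let 0<h      = subst (0 <_) (sym h≡) (s≤s z≤n)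
        (s , ok) = strategy x (inv 0<h) 0<h
    in step-geodesic s (proj₂ ∘ ok)
         (follow n (next s) (suc-injective (trans (sym (closer s)) h≡)) (proj₁ ∘ ok))

Between Near : ℕ → ℕ → Set
Between m w = m ≤ w × w ≤ suc m
Near    m w = m ≤ suc w × w ≤ suc (suc m)

between⇒near : ∀ {m w} → Between m w → Near m w
between⇒near (m≤w , w≤1+m) = m≤n⇒m≤1+n m≤w , m≤n⇒m≤1+n w≤1+m

band : ∀ {m} (x y : QVertex d) → Near m (weight x) → Near m (weight y) →
       Geodesic (Between m) x y
band {m = m} x y x-near y-near = strategy⇒geodesic strategy x x-near
  where
  inside : ∀ {w} → Between m w → Near m w × Between m w
  inside w-between = between⇒near w-between , w-between

  strategy : Strategy (Between m) (Near m ∘ weight) y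
  strategy z z-near 0<h with weight z ≤? m
  strategy z z-near 0<h | yes z≤m with up z y in up≡
  ... | suc _ = let (s , heavier , _) = step-up z y up≡
                    next-between      = subst (Between m) (sym heavier)
                                              (proj₁ z-near , s≤s z≤m)
                in s , λ _ → inside next-between
  ... | zero  = let (s , lighter , above-y) = descend z y up≡ 0<h
                    next<m = <-≤-trans (≤-reflexive (sym lighter)) z≤m
                in s , λ 0<h′ →
                     let next-between = ≤-trans (proj₁ y-near) (above-y 0<h′)
                                      , m≤n⇒m≤1+n (<⇒≤ next<m)
                     in inside next-between
  strategy z z-near 0<h | no z≰m with down z y in down≡
  ... | suc _ = let (s , lighter , _) = step-down z y down≡
                    next-between      = s≤s⁻¹ (subst (suc m ≤_) lighter (≰⇒> z≰m))
                                      , s≤s⁻¹ (subst (_≤ suc (suc m)) lighter (proj₂ z-near))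
                in s , λ _ → inside next-between
  ... | zero  = let (s , heavier , below-y) = ascend z y down≡ 0<h
                    m≤next = subst (m ≤_) (sym heavier) (m≤n⇒m≤1+n (<⇒≤ (≰⇒> z≰m)))
                in s , λ 0<h′ →
                     let next-between = m≤next , s≤s⁻¹ (<-≤-trans (below-y 0<h′) (proj₂ y-near))
                     in inside next-between

outer-levels-mutual-visibility :
  ∀ {k} (X : List (QVertex d)) → Unique X →
  (∀ {v} → v ∈ X → weight v ≡ k ⊎ weight v ≡ 3 + k) → IsMutualVisibility (QAdj d) X
outer-levels-mutual-visibility {k = k} X unique ∈X⇒weight =
  unique , λ x y x∈ y∈ → geodesic⇒visible (_∈ X) avoid (band x y (near x∈) (near y∈))
  where
  near : ∀ {v} → v ∈ X → Near (suc k) (weight v)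
  near v∈ with ∈X⇒weight v∈
  ... | inj₁ v≡k   = s≤s (≤-reflexive (sym v≡k)) , ≤-trans (≤-reflexive v≡k) (m≤n+m k 3)
  ... | inj₂ v≡3+k = ≤-trans (s≤s (m≤n+m k 3)) (s≤s (≤-reflexive (sym v≡3+k))) , ≤-reflexive v≡3+k

  avoid : ∀ v → Between (suc k) (weight v) → ¬ v ∈ X
  avoid v (k<v , v≤2+k) v∈ with ∈X⇒weight v∈
  ... | inj₁ v≡k   = >⇒≢ k<v v≡k
  ... | inj₂ v≡3+k = <⇒≢ (s≤s v≤2+k) v≡3+k

level : (d j : ℕ) → List (QVertex d)
level zero    zero    = [ [] ]
level zero    (suc j) = []
level (suc d) zero    = map (false ∷_) (level d zero)
level (suc d) (suc j) = map (true ∷_) (level d j) ++ map (false ∷_) (level d (suc j))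

∈-level⇒weight : ∀ d j (v : QVertex d) → v ∈ level d j → weight v ≡ j
∈-level⇒weight zero    zero    [] _ = refl
∈-level⇒weight zero    (suc j) v  ()
∈-level⇒weight (suc d) zero    v  v∈ with ∈-map⁻ (false ∷_) v∈
... | u , u∈ , refl = ∈-level⇒weight d zero u u∈
∈-level⇒weight (suc d) (suc j) v  v∈ with ∈-++⁻ (map (true ∷_) (level d j)) v∈
... | inj₁ v∈₁ with ∈-map⁻ (true ∷_) v∈₁
...   | u , u∈ , refl = cong suc (∈-level⇒weight d j u u∈)
∈-level⇒weight (suc d) (suc j) v  v∈ | inj₂ v∈₂ with ∈-map⁻ (false ∷_) v∈₂
...   | u , u∈ , refl = ∈-level⇒weight d (suc j) u u∈

level-unique : ∀ d j → Unique (level d j)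
level-unique zero    zero    = [] ∷ []
level-unique zero    (suc j) = []
level-unique (suc d) zero    = Unique.map⁺ ∷-injectiveʳ (level-unique d zero)
level-unique (suc d) (suc j) =
  Unique.++⁺ (Unique.map⁺ ∷-injectiveʳ (level-unique d j))
             (Unique.map⁺ ∷-injectiveʳ (level-unique d (suc j))) disjoint
  where
  disjoint : ∀ {v} → ¬ (v ∈ map (true ∷_) (level d j) × v ∈ map (false ∷_) (level d (suc j)))
  disjoint (v∈₁ , v∈₂) with ∈-map⁻ (true ∷_) v∈₁ | ∈-map⁻ (false ∷_) v∈₂
  ... | _ , _ , refl | _ , _ , ()

length-level : ∀ d j → length (level d j) ≡ d C j
length-level zero    zero    = refl
length-level zero    (suc j) = refl
length-level (suc d) zero    = trans (length-map (false ∷_) (level d zero)) (length-level d zero)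
length-level (suc d) (suc j) = begin
  length (map (true ∷_) (level d j) ++ map (false ∷_) (level d (suc j)))
    ≡⟨ length-++ (map (true ∷_) (level d j)) ⟩
  length (map (true ∷_) (level d j)) + length (map (false ∷_) (level d (suc j)))
    ≡⟨ cong₂ _+_ (length-map (true ∷_) (level d j)) (length-map (false ∷_) (level d (suc j))) ⟩
  length (level d j) + length (level d (suc j))
    ≡⟨ cong₂ _+_ (length-level d j) (length-level d (suc j)) ⟩
  d C j + d C suc j
    ≡⟨ nCk+nC[k+1]≡[n+1]C[k+1] d j ⟩
  suc d C suc j
    ∎
  where open ≡-Reasoning

levels-mutual-visibility : ∀ d k → IsMutualVisibility (QAdj d) (level d k ++ level d (3 + k))
levels-mutual-visibility d k = outer-levels-mutual-visibility _ unique ∈-levels⇒weight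
  where
  ∈-levels⇒weight : ∀ {v} → v ∈ level d k ++ level d (3 + k) → weight v ≡ k ⊎ weight v ≡ 3 + k
  ∈-levels⇒weight {v} v∈ with ∈-++⁻ (level d k) v∈
  ... | inj₁ v∈k   = inj₁ (∈-level⇒weight d k v v∈k)
  ... | inj₂ v∈3+k = inj₂ (∈-level⇒weight d (3 + k) v v∈3+k)

  unique : Unique (level d k ++ level d (3 + k))
  unique = Unique.++⁺ (level-unique d k) (level-unique d (3 + k)) λ {v} (v∈k , v∈3+k) →
    <⇒≢ (m<n+m k (s≤s z≤n)) (trans (sym (∈-level⇒weight d k v v∈k)) (∈-level⇒weight d (3 + k) v v∈3+k))

-- Every level k works, for every d; k = ⌊d/2⌋ maximises the first binomial coefficient.
theorem1 : (d : ℕ) → 1 ≤ d →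
    μ≥ (QAdj d) ((d C (d / 2)) + (d C ((d / 2) + 3)))
theorem1 d _ = level d k ++ level d (3 + k) , levels-mutual-visibility d k , ≤-reflexive (begin
  d C k + d C (k + 3)                           ≡⟨ cong (λ j → d C k + d C j) (+-comm k 3) ⟩
  d C k + d C (3 + k)                           ≡⟨ cong₂ _+_ (length-level d k) (length-level d (3 + k)) ⟨
  length (level d k) + length (level d (3 + k)) ≡⟨ length-++ (level d k) ⟨
  length (level d k ++ level d (3 + k))         ∎)
  where
  k = d / 2
  open ≡-Reasoning
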